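{- Let $X=\{x_{1},\ldots,x_{l}\}$ and $Y=\{ -y_{1},\ldots,-y_{m}\}$ be disjoint nonempty sets of odd integers, where $x_{1}>\cdots>x_{l}$ are positive odd integers and $y_{1}<\cdots<y_{m}$ are positive odd integers. Let $L=\sum_{i=1}^{l}x_{i}$, $M=\sum_{i=1}^{m}y_{i}$ and $n=lM+mL$. Then there exists a tournament of order $n$ whose imbalance set is $X\cup Y$.
   Context: A tournament is an orientation of a complete simple graph; its order is its number of vertices. The imbalance of a vertex $v$ in a digraph is $d^{+}(v)-d^{ - }(v)$ (outdegree minus indegree). The imbalance set of a digraph is the set of imbalances of its vertices. -}

module Defs where

open import Data.Nat using (ℕ; zero; suc; _+_; _*_; _<_; _>_)
open import Data.Integer using (ℤ; +_; -_; _-_)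
open import Data.Bool using (Bool; true; false; not; if_then_else_)
open import Data.Fin using (Fin)
open import Data.List using (List; allFin; map; length)
open import Data.Nat.ListAction using (sum)
open import Data.List.Membership.Propositional using (_∈_)
open import Data.Product using (∃; _×_)
open import Data.Sum using (_⊎_)
open import Relation.Binary.PropositionalEquality using (_≡_; _≢_)
open import Relation.Nullary using (¬_)

Odd : ℕ → Set
Odd x = ∃ λ k → x ≡ suc (2 * k)

-- A digraph on vertex set Fin n given by adjacency: A i j = true iff arc i → j.
-- It is a tournament: no loops, and for distinct vertices exactly one arc.
record IsTournament (n : ℕ) (A : Fin n → Fin n → Bool) : Set where
  field
    irrefl : ∀ i → A i i ≡ false
    exactlyOne : ∀ i j → i ≢ j → A i j ≡ not (A j i)

count : ∀ {n} → (Fin n → Bool) → ℕ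
count {n} p = sum (map (λ j → if p j then 1 else 0) (allFin n))

outdeg : ∀ {n} → (Fin n → Fin n → Bool) → Fin n → ℕ
outdeg A v = count (λ j → A v j)

indeg : ∀ {n} → (Fin n → Fin n → Bool) → Fin n → ℕ
indeg A v = count (λ j → A j v)

imbalance : ∀ {n} → (Fin n → Fin n → Bool) → Fin n → ℤ
imbalance A v = + outdeg A v - + indeg A v

ImbalanceSetIs : ∀ {n} → (Fin n → Fin n → Bool) → (ℤ → Set) → Set
ImbalanceSetIs {n} A S = ∀ z → (S z → ∃ λ (v : Fin n) → imbalance A v ≡ z)
                             × ((∃ λ (v : Fin n) → imbalance A v ≡ z) → S z)

data StrictDec : List ℕ → Set where
  []  : StrictDec Data.List.[]
  [_] : ∀ x → StrictDec (x Data.List.∷ Data.List.[])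
  _∷_ : ∀ {x y ys} → x > y → StrictDec (y Data.List.∷ ys) → StrictDec (x Data.List.∷ y Data.List.∷ ys)

data StrictInc : List ℕ → Set where
  []  : StrictInc Data.List.[]
  [_] : ∀ x → StrictInc (x Data.List.∷ Data.List.[])
  _∷_ : ∀ {x y ys} → x < y → StrictInc (y Data.List.∷ ys) → StrictInc (x Data.List.∷ y Data.List.∷ ys)

XunionY : List ℕ → List ℕ → ℤ → Set
XunionY xs ys z = (∃ λ x → x ∈ xs × z ≡ + x) ⊎ (∃ λ y → y ∈ ys × z ≡ - (+ y))

-- Each pair (xᵢ, yⱼ) gives a block of order xᵢ + yⱼ: a regular tournament on xᵢ vertices all
-- of whose vertices lose to a regular tournament on yⱼ vertices, so the two parts have
-- imbalances −yⱼ and +xᵢ.  Blocks have even order, and two tournaments of even order can be joined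
-- without changing any imbalance by letting p → q exactly when p and q have indices of different
-- parity: along every row and column of the cross arcs the direction alternates, so the
-- contributions cancel in pairs.  Joining all l·m blocks gives order Σ (xᵢ + yⱼ) = lM + mL and
-- imbalance set X ∪ Y.  Regular tournaments of odd order are built the same way, by joining a
-- single arc to a smaller regular tournament through the parity pattern.
module Submission where

open import Defs
open import Data.Nat using (ℕ; _+_; _*_; _<_; _≥_)
open import Data.List using (List; length)
open import Data.Nat.ListAction using (sum)
open import Data.List.Relation.Unary.All using (All)
open import Data.Bool using (Bool)
open import Data.Fin using (Fin)
open import Data.Product using (Σ; _×_)

open import Data.Bool using (true; false; not; _xor_; if_then_else_)
open import Data.Bool.Properties using (not-involutive; not-distribˡ-xor; not-distribʳ-xor; xor-identityʳ)
open import Data.Empty using (⊥-elim)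
open import Data.Fin using (zero; suc; toℕ; splitAt; join; _↑ˡ_; _↑ʳ_)
open import Data.Fin.Properties using (splitAt-↑ˡ; splitAt-↑ʳ; join-splitAt)
open import Data.Integer as ℤ using (ℤ; +_; -_; _-_; 0ℤ; 1ℤ; -1ℤ)
import Data.Integer.Properties as ℤ
open import Algebra.Properties.CommutativeMonoid.Sum ℤ.+-0-commutativeMonoid
  using (sum-syntax; sum-cong-≗; ∑-distrib-+) renaming (sum to ∑)
open import Data.List using ([]; _∷_; _++_; map; tabulate; cartesianProduct)
open import Data.List.Properties using (map-tabulate; map-++)
open import Data.List.Membership.Propositional using (_∈_; find; lose)
open import Data.List.Membership.Propositional.Properties using (∈-cartesianProduct⁺; ∈-cartesianProduct⁻)
open import Data.List.Relation.Unary.All as All using ([]; _∷_)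
open import Data.List.Relation.Unary.Any using (Any; here; fromSum; toSum)
open import Data.Nat using (zero; suc)
open import Data.Nat.ListAction.Properties using (sum-++)
open import Data.Nat.Properties using (+-suc; *-zeroʳ)
open import Data.Nat.Tactic.RingSolver using (solve-∀)
open import Data.Product using (∃; _,_; proj₁; proj₂; uncurry)
open import Data.Sum using (_⊎_; inj₁; inj₂)
open import Function using (_∘_)
open import Relation.Binary.PropositionalEquality
open import Relation.Unary using (_≐_; _∪_)
open ≡-Reasoning

data Even : ℕ → Set where
  zero : Even 0
  2+   : ∀ {n} → Even n → Even (suc (suc n))

even-+ : ∀ {m n} → Even m → Even n → Even (m + n)
even-+ zero    en = en
even-+ (2+ em) en = 2+ (even-+ em en)

even-2* : ∀ k → Even (2 * k)
even-2* zero    = zero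
even-2* (suc k) = subst (Even ∘ suc) (sym (+-suc k (k + 0))) (2+ (even-2* k))

odd⇒suc-even : ∀ {x} → Odd x → ∃ λ e → Even e × x ≡ suc e
odd⇒suc-even (k , refl) = 2 * k , even-2* k , refl

odd+odd-even : ∀ {x y} → Odd x → Odd y → Even (x + y)
odd+odd-even ox oy with odd⇒suc-even ox | odd⇒suc-even oy
... | e , ee , refl | f , ef , refl = subst (Even ∘ suc) (sym (+-suc e f)) (2+ (even-+ ee ef))

∑-neg : ∀ n (f : Fin n → ℤ) → ∑[ i < n ] (- f i) ≡ - (∑[ i < n ] f i)
∑-neg zero    f = refl
∑-neg (suc n) f = begin
  - f zero ℤ.+ ∑[ i < n ] (- f (suc i))  ≡⟨ cong (ℤ._+_ (- f zero)) (∑-neg n (f ∘ suc)) ⟩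
  - f zero ℤ.+ - (∑[ i < n ] f (suc i))  ≡⟨ ℤ.neg-distrib-+ (f zero) _ ⟨
  - (f zero ℤ.+ ∑[ i < n ] f (suc i))    ∎

∑-distrib-- : ∀ n (f g : Fin n → ℤ) → ∑[ i < n ] (f i - g i) ≡ ∑[ i < n ] f i - ∑[ i < n ] g i
∑-distrib-- n f g = begin
  ∑[ i < n ] (f i - g i)                 ≡⟨ ∑-distrib-+ f (λ i → - g i) ⟩
  ∑[ i < n ] f i ℤ.+ ∑[ i < n ] (- g i)  ≡⟨ cong (ℤ._+_ (∑[ i < n ] f i)) (∑-neg n g) ⟩
  ∑[ i < n ] f i - ∑[ i < n ] g i        ∎

∑-1 : ∀ n → ∑[ i < n ] 1ℤ ≡ + n
∑-1 zero    = refl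
∑-1 (suc n) = cong (ℤ._+_ 1ℤ) (∑-1 n)

∑-split : ∀ a b (f : Fin (a + b) → ℤ) →
          ∑[ i < a + b ] f i ≡ ∑[ i < a ] f (i ↑ˡ b) ℤ.+ ∑[ j < b ] f (a ↑ʳ j)
∑-split zero    b f = sym (ℤ.+-identityˡ _)
∑-split (suc a) b f = begin
  f zero ℤ.+ ∑[ i < a + b ] f (suc i)
    ≡⟨ cong (ℤ._+_ (f zero)) (∑-split a b (f ∘ suc)) ⟩
  f zero ℤ.+ (∑[ i < a ] f (suc (i ↑ˡ b)) ℤ.+ ∑[ j < b ] f (suc a ↑ʳ j))
    ≡⟨ ℤ.+-assoc (f zero) _ _ ⟨
  (f zero ℤ.+ ∑[ i < a ] f (suc (i ↑ˡ b))) ℤ.+ ∑[ j < b ] f (suc a ↑ʳ j)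
    ∎

∑-alternating : ∀ (s : ℕ → ℤ) → (∀ n → s n ℤ.+ s (suc n) ≡ 0ℤ) →
                ∀ {k} → Even k → ∑[ j < k ] s (toℕ j) ≡ 0ℤ
∑-alternating s cancel zero        = refl
∑-alternating s cancel (2+ {k} ek) = begin
  s 0 ℤ.+ (s 1 ℤ.+ ∑[ j < k ] s (2 + toℕ j))  ≡⟨ cong (λ t → s 0 ℤ.+ (s 1 ℤ.+ t)) tail≡0 ⟩
  s 0 ℤ.+ (s 1 ℤ.+ 0ℤ)                        ≡⟨ cong (ℤ._+_ (s 0)) (ℤ.+-identityʳ (s 1)) ⟩
  s 0 ℤ.+ s 1                                 ≡⟨ cancel 0 ⟩
  0ℤ                                          ∎
  where
  tail≡0 : ∑[ j < k ] s (2 + toℕ j) ≡ 0ℤ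
  tail≡0 = ∑-alternating (λ n → s (2 + n)) (λ n → cancel (2 + n)) ek

∑-alternating-odd : ∀ (s : ℕ → ℤ) → (∀ n → s n ℤ.+ s (suc n) ≡ 0ℤ) →
                    ∀ {k} → Even k → ∑[ j < suc k ] s (toℕ j) ≡ s 0
∑-alternating-odd s cancel {k} ek = begin
  s 0 ℤ.+ ∑[ j < k ] s (suc (toℕ j))  ≡⟨ cong (ℤ._+_ (s 0)) tail≡0 ⟩
  s 0 ℤ.+ 0ℤ                          ≡⟨ ℤ.+-identityʳ (s 0) ⟩
  s 0                                 ∎
  where
  tail≡0 : ∑[ j < k ] s (suc (toℕ j)) ≡ 0ℤ
  tail≡0 = ∑-alternating (λ n → s (suc n)) (λ n → cancel (suc n)) ek

𝟙 : Bool → ℤ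
𝟙 true  = 1ℤ
𝟙 false = 0ℤ

±_ : Bool → ℤ
± true  = 1ℤ
± false = -1ℤ

net : Bool → Bool → ℤ
net s t = 𝟙 s - 𝟙 t

net-not : ∀ b → net b (not b) ≡ ± b
net-not true  = refl
net-not false = refl

net-not˘ : ∀ b → net (not b) b ≡ ± not b
net-not˘ true  = refl
net-not˘ false = refl

±-not : ∀ b → ± b ℤ.+ ± not b ≡ 0ℤ
±-not true  = refl
±-not false = refl

+sum-tabulate : ∀ n (h : Fin n → ℕ) → + sum (tabulate h) ≡ ∑[ j < n ] (+ h j)
+sum-tabulate zero    h = refl
+sum-tabulate (suc n) h = begin
  + (h zero + sum (tabulate (h ∘ suc)))      ≡⟨ ℤ.pos-+ (h zero) _ ⟩
  + h zero ℤ.+ + sum (tabulate (h ∘ suc))    ≡⟨ cong (ℤ._+_ (+ h zero)) (+sum-tabulate n (h ∘ suc)) ⟩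
  + h zero ℤ.+ ∑[ j < n ] (+ h (suc j))        ∎

+count≡∑ : ∀ {n} (p : Fin n → Bool) → + count p ≡ ∑[ j < n ] 𝟙 (p j)
+count≡∑ {n} p = begin
  + sum (map indicator (tabulate (λ j → j)))  ≡⟨ cong (+_ ∘ sum) (map-tabulate (λ j → j) indicator) ⟩
  + sum (tabulate indicator)                  ≡⟨ +sum-tabulate n indicator ⟩
  ∑[ j < n ] (+ indicator j)                   ≡⟨ sum-cong-≗ (λ j → +-if (p j)) ⟩
  ∑[ j < n ] 𝟙 (p j)                          ∎
  where
  indicator : Fin n → ℕ
  indicator j = if p j then 1 else 0
  +-if : ∀ b → + (if b then 1 else 0) ≡ 𝟙 b
  +-if true  = refl
  +-if false = refl

imbalance-∑ : ∀ {n} (A : Fin n → Fin n → Bool) v → imbalance A v ≡ ∑[ j < n ] net (A v j) (A j v)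
imbalance-∑ {n} A v = begin
  + outdeg A v - + indeg A v                         ≡⟨ cong₂ _-_ (+count≡∑ (A v)) (+count≡∑ (λ j → A j v)) ⟩
  ∑[ j < n ] 𝟙 (A v j) - ∑[ j < n ] 𝟙 (A j v)        ≡⟨ ∑-distrib-- n _ _ ⟨
  ∑[ j < n ] net (A v j) (A j v)                     ∎

glue : ∀ {a b} → (Fin a → Fin a → Bool) → (Fin b → Fin b → Bool) → (Fin a → Fin b → Bool) →
       Fin (a + b) → Fin (a + b) → Bool
glue {a} {b} A B C i j = arcs (splitAt a i) (splitAt a j)
  where
  arcs : Fin a ⊎ Fin b → Fin a ⊎ Fin b → Bool
  arcs (inj₁ p) (inj₁ p') = A p p'
  arcs (inj₁ p) (inj₂ q)  = C p q
  arcs (inj₂ q) (inj₁ p)  = not (C p q)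
  arcs (inj₂ q) (inj₂ q') = B q q'

data SplitView a b : Fin (a + b) → Set where
  left  : ∀ p → SplitView a b (p ↑ˡ b)
  right : ∀ q → SplitView a b (a ↑ʳ q)

splitView : ∀ a b v → SplitView a b v
splitView a b v = subst (SplitView a b) (join-splitAt a b v) (view (splitAt a v))
  where
  view : ∀ s → SplitView a b (join a b s)
  view (inj₁ p) = left p
  view (inj₂ q) = right q

module _ {a b} {A : Fin a → Fin a → Bool} {B : Fin b → Fin b → Bool} {C : Fin a → Fin b → Bool} where

  glue-↑ˡ-↑ˡ : ∀ p p' → glue A B C (p ↑ˡ b) (p' ↑ˡ b) ≡ A p p'
  glue-↑ˡ-↑ˡ p p' rewrite splitAt-↑ˡ a p b | splitAt-↑ˡ a p' b = refl

  glue-↑ˡ-↑ʳ : ∀ p q → glue A B C (p ↑ˡ b) (a ↑ʳ q) ≡ C p q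
  glue-↑ˡ-↑ʳ p q rewrite splitAt-↑ˡ a p b | splitAt-↑ʳ a b q = refl

  glue-↑ʳ-↑ˡ : ∀ q p → glue A B C (a ↑ʳ q) (p ↑ˡ b) ≡ not (C p q)
  glue-↑ʳ-↑ˡ q p rewrite splitAt-↑ʳ a b q | splitAt-↑ˡ a p b = refl

  glue-↑ʳ-↑ʳ : ∀ q q' → glue A B C (a ↑ʳ q) (a ↑ʳ q') ≡ B q q'
  glue-↑ʳ-↑ʳ q q' rewrite splitAt-↑ʳ a b q | splitAt-↑ʳ a b q' = refl

  glue-isTournament : IsTournament a A → IsTournament b B → IsTournament (a + b) (glue A B C)
  glue-isTournament tA tB = record { irrefl = irrefl ; exactlyOne = exactlyOne }
    where
    irrefl : ∀ v → glue A B C v v ≡ false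
    irrefl v with splitView a b v
    ... | left p  rewrite glue-↑ˡ-↑ˡ p p = IsTournament.irrefl tA p
    ... | right q rewrite glue-↑ʳ-↑ʳ q q = IsTournament.irrefl tB q
    exactlyOne : ∀ u v → u ≢ v → glue A B C u v ≡ not (glue A B C v u)
    exactlyOne u v u≢v with splitView a b u | splitView a b v
    ... | left p  | left p'  rewrite glue-↑ˡ-↑ˡ p p' | glue-↑ˡ-↑ˡ p' p =
      IsTournament.exactlyOne tA p p' (u≢v ∘ cong (_↑ˡ b))
    ... | left p  | right q  rewrite glue-↑ˡ-↑ʳ p q | glue-↑ʳ-↑ˡ q p = sym (not-involutive (C p q))
    ... | right q | left p   rewrite glue-↑ʳ-↑ˡ q p | glue-↑ˡ-↑ʳ p q = refl
    ... | right q | right q' rewrite glue-↑ʳ-↑ʳ q q' | glue-↑ʳ-↑ʳ q' q =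
      IsTournament.exactlyOne tB q q' (u≢v ∘ cong (a ↑ʳ_))

  imbalance-glue-↑ˡ : ∀ p → imbalance (glue A B C) (p ↑ˡ b) ≡ imbalance A p ℤ.+ ∑[ q < b ] ± C p q
  imbalance-glue-↑ˡ p = begin
    imbalance G (p ↑ˡ b)                                             ≡⟨ imbalance-∑ G (p ↑ˡ b) ⟩
    ∑[ v < a + b ] net (G (p ↑ˡ b) v) (G v (p ↑ˡ b))                 ≡⟨ ∑-split a b _ ⟩
    ∑[ i < a ] net (G (p ↑ˡ b) (i ↑ˡ b)) (G (i ↑ˡ b) (p ↑ˡ b))
      ℤ.+ ∑[ q < b ] net (G (p ↑ˡ b) (a ↑ʳ q)) (G (a ↑ʳ q) (p ↑ˡ b)) ≡⟨ cong₂ ℤ._+_ (sum-cong-≗ inner) (sum-cong-≗ cross) ⟩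
    ∑[ i < a ] net (A p i) (A i p) ℤ.+ ∑[ q < b ] ± C p q             ≡⟨ cong (ℤ._+ _) (imbalance-∑ A p) ⟨
    imbalance A p ℤ.+ ∑[ q < b ] ± C p q                             ∎
    where
    G : Fin (a + b) → Fin (a + b) → Bool
    G = glue A B C
    inner : ∀ i → net (G (p ↑ˡ b) (i ↑ˡ b)) (G (i ↑ˡ b) (p ↑ˡ b)) ≡ net (A p i) (A i p)
    inner i = cong₂ net (glue-↑ˡ-↑ˡ p i) (glue-↑ˡ-↑ˡ i p)
    cross : ∀ q → net (G (p ↑ˡ b) (a ↑ʳ q)) (G (a ↑ʳ q) (p ↑ˡ b)) ≡ ± C p q
    cross q = trans (cong₂ net (glue-↑ˡ-↑ʳ p q) (glue-↑ʳ-↑ˡ q p)) (net-not (C p q))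

  imbalance-glue-↑ʳ : ∀ q → imbalance (glue A B C) (a ↑ʳ q) ≡ ∑[ p < a ] ± not (C p q) ℤ.+ imbalance B q
  imbalance-glue-↑ʳ q = begin
    imbalance G (a ↑ʳ q)                                             ≡⟨ imbalance-∑ G (a ↑ʳ q) ⟩
    ∑[ v < a + b ] net (G (a ↑ʳ q) v) (G v (a ↑ʳ q))                 ≡⟨ ∑-split a b _ ⟩
    ∑[ p < a ] net (G (a ↑ʳ q) (p ↑ˡ b)) (G (p ↑ˡ b) (a ↑ʳ q))
      ℤ.+ ∑[ j < b ] net (G (a ↑ʳ q) (a ↑ʳ j)) (G (a ↑ʳ j) (a ↑ʳ q)) ≡⟨ cong₂ ℤ._+_ (sum-cong-≗ cross) (sum-cong-≗ inner) ⟩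
    ∑[ p < a ] ± not (C p q) ℤ.+ ∑[ j < b ] net (B q j) (B j q)       ≡⟨ cong (ℤ._+_ (∑[ p < a ] ± not (C p q))) (imbalance-∑ B q) ⟨
    ∑[ p < a ] ± not (C p q) ℤ.+ imbalance B q                       ∎
    where
    G : Fin (a + b) → Fin (a + b) → Bool
    G = glue A B C
    cross : ∀ p → net (G (a ↑ʳ q) (p ↑ˡ b)) (G (p ↑ˡ b) (a ↑ʳ q)) ≡ ± not (C p q)
    cross p = trans (cong₂ net (glue-↑ʳ-↑ˡ q p) (glue-↑ˡ-↑ʳ p q)) (net-not˘ (C p q))
    inner : ∀ j → net (G (a ↑ʳ q) (a ↑ʳ j)) (G (a ↑ʳ j) (a ↑ʳ q)) ≡ net (B q j) (B j q)
    inner j = cong₂ net (glue-↑ʳ-↑ʳ q j) (glue-↑ʳ-↑ʳ j q)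

isOdd : ℕ → Bool
isOdd zero    = false
isOdd (suc n) = not (isOdd n)

parityCross : ∀ {a b} → Fin a → Fin b → Bool
parityCross p q = isOdd (toℕ p) xor isOdd (toℕ q)

±-alternating : ∀ (g : ℕ → Bool) → (∀ n → g (suc n) ≡ not (g n)) → ∀ n → ± g n ℤ.+ ± g (suc n) ≡ 0ℤ
±-alternating g g-alt n = trans (cong (λ c → ± g n ℤ.+ ± c) (g-alt n)) (±-not (g n))

row-alternating : ∀ s n → ± (s xor isOdd n) ℤ.+ ± (s xor isOdd (suc n)) ≡ 0ℤ
row-alternating s = ±-alternating (λ n → s xor isOdd n) (λ n → sym (not-distribʳ-xor s (isOdd n)))

column-alternating : ∀ t n → ± not (isOdd n xor t) ℤ.+ ± not (isOdd (suc n) xor t) ≡ 0ℤ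
column-alternating t = ±-alternating (λ n → not (isOdd n xor t)) (λ n → cong not (sym (not-distribˡ-xor (isOdd n) t)))

∑-parityCross-row : ∀ {a b} (p : Fin a) → Even b → ∑[ q < b ] ± parityCross p q ≡ 0ℤ
∑-parityCross-row p = ∑-alternating (λ n → ± (isOdd (toℕ p) xor isOdd n)) (row-alternating (isOdd (toℕ p)))

∑-parityCross-column : ∀ {a b} (q : Fin b) → Even a → ∑[ p < a ] ± not (parityCross p q) ≡ 0ℤ
∑-parityCross-column q = ∑-alternating (λ n → ± not (isOdd n xor isOdd (toℕ q))) (column-alternating (isOdd (toℕ q)))

∑-parityCross-row-odd : ∀ {a e} (p : Fin a) → Even e → ∑[ q < suc e ] ± parityCross p q ≡ ± isOdd (toℕ p)
∑-parityCross-row-odd p ee = trans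
  (∑-alternating-odd (λ n → ± (isOdd (toℕ p) xor isOdd n)) (row-alternating (isOdd (toℕ p))) ee)
  (cong ±_ (xor-identityʳ (isOdd (toℕ p))))

module _ {a b} {A : Fin a → Fin a → Bool} {B : Fin b → Fin b → Bool} where

  imbalance-glue-parity-↑ˡ : Even b → ∀ p → imbalance (glue A B parityCross) (p ↑ˡ b) ≡ imbalance A p
  imbalance-glue-parity-↑ˡ eb p = begin
    imbalance (glue A B parityCross) (p ↑ˡ b)       ≡⟨ imbalance-glue-↑ˡ p ⟩
    imbalance A p ℤ.+ ∑[ q < b ] ± parityCross p q  ≡⟨ cong (ℤ._+_ (imbalance A p)) (∑-parityCross-row p eb) ⟩
    imbalance A p ℤ.+ 0ℤ                            ≡⟨ ℤ.+-identityʳ _ ⟩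
    imbalance A p                                   ∎

  imbalance-glue-parity-↑ʳ : Even a → ∀ q → imbalance (glue A B parityCross) (a ↑ʳ q) ≡ imbalance B q
  imbalance-glue-parity-↑ʳ ea q = begin
    imbalance (glue A B parityCross) (a ↑ʳ q)             ≡⟨ imbalance-glue-↑ʳ {A = A} q ⟩
    ∑[ p < a ] ± not (parityCross p q) ℤ.+ imbalance B q  ≡⟨ cong (ℤ._+ imbalance B q) (∑-parityCross-column q ea) ⟩
    0ℤ ℤ.+ imbalance B q                                  ≡⟨ ℤ.+-identityˡ _ ⟩
    imbalance B q                                         ∎

IsRegular : ∀ {n} → (Fin n → Fin n → Bool) → Set
IsRegular A = ∀ v → imbalance A v ≡ 0ℤ

RegularTournament : ℕ → Set
RegularTournament n = Σ (Fin n → Fin n → Bool) λ A → IsTournament n A × IsRegular A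

singleton-isTournament : IsTournament 1 (λ _ _ → false)
singleton-isTournament = record { irrefl = λ _ → refl ; exactlyOne = λ { zero zero 0≢0 → ⊥-elim (0≢0 refl) } }

arc : Fin 2 → Fin 2 → Bool
arc zero (suc zero) = true
arc _    _          = false

arc-isTournament : IsTournament 2 arc
arc-isTournament = record { irrefl = λ { zero → refl ; (suc zero) → refl } ; exactlyOne = exactlyOne }
  where
  exactlyOne : ∀ i j → i ≢ j → arc i j ≡ not (arc j i)
  exactlyOne zero       zero       0≢0 = ⊥-elim (0≢0 refl)
  exactlyOne zero       (suc zero) _   = refl
  exactlyOne (suc zero) zero       _   = refl
  exactlyOne (suc zero) (suc zero) 1≢1 = ⊥-elim (1≢1 refl)

-- The ±1 of the arc is compensated inside an odd part of order 2r + 1: vertex 0 beats its r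
-- odd-indexed vertices and loses to the r + 1 even-indexed ones, vertex 1 the other way round.
imbalance-arc+parity : ∀ p → imbalance arc p ℤ.+ ± isOdd (toℕ p) ≡ 0ℤ
imbalance-arc+parity zero       = refl
imbalance-arc+parity (suc zero) = refl

regular : ∀ {e} → Even e → RegularTournament (suc e)
regular zero = (λ _ _ → false) , singleton-isTournament , λ { zero → refl }
regular {suc (suc e)} (2+ ee) with regular ee
... | R , tR , regR = glue arc R parityCross , glue-isTournament arc-isTournament tR , balanced
  where
  balanced : IsRegular (glue arc R parityCross)
  balanced v with splitView 2 (suc e) v
  ... | left p  = begin
    imbalance (glue arc R parityCross) (p ↑ˡ suc e)        ≡⟨ imbalance-glue-↑ˡ p ⟩
    imbalance arc p ℤ.+ ∑[ q < suc e ] ± parityCross p q   ≡⟨ cong (ℤ._+_ (imbalance arc p)) (∑-parityCross-row-odd p ee) ⟩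
    imbalance arc p ℤ.+ ± isOdd (toℕ p)                    ≡⟨ imbalance-arc+parity p ⟩
    0ℤ                                                     ∎
  ... | right q = trans (imbalance-glue-parity-↑ʳ (2+ zero) q) (regR q)

odd⇒Fin : ∀ {x} → Odd x → Fin x
odd⇒Fin (k , refl) = zero

regular-odd : ∀ {x} → Odd x → RegularTournament x
regular-odd ox with odd⇒suc-even ox
... | _ , ee , refl = regular ee

TournamentWithImbalanceSet : ℕ → (ℤ → Set) → Set
TournamentWithImbalanceSet n S = Σ (Fin n → Fin n → Bool) λ A → IsTournament n A × ImbalanceSetIs A S

imbalanceSet-≐ : ∀ {n S T} → S ≐ T → TournamentWithImbalanceSet n S → TournamentWithImbalanceSet n T
imbalanceSet-≐ (S⊆T , T⊆S) (A , tA , setA) = A , tA , λ z → proj₁ (setA z) ∘ T⊆S , S⊆T ∘ proj₂ (setA z)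

blockSet : ℕ × ℕ → ℤ → Set
blockSet (x , y) z = z ≡ + x ⊎ z ≡ - (+ y)

block : ∀ {x y} → Odd x → Odd y → TournamentWithImbalanceSet (x + y) (blockSet (x , y))
block {x} {y} ox oy with regular-odd ox | regular-odd oy
... | X , tX , regX | Y , tY , regY = A , glue-isTournament tX tY , imbalances
  where
  A : Fin (x + y) → Fin (x + y) → Bool
  A = glue X Y (λ _ _ → false)

  imbalance-↑ˡ : ∀ p → imbalance A (p ↑ˡ y) ≡ - (+ y)
  imbalance-↑ˡ p = begin
    imbalance A (p ↑ˡ y)                 ≡⟨ imbalance-glue-↑ˡ p ⟩
    imbalance X p ℤ.+ ∑[ q < y ] (- 1ℤ)  ≡⟨ cong₂ ℤ._+_ (regX p) (trans (∑-neg y (λ _ → 1ℤ)) (cong -_ (∑-1 y))) ⟩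
    0ℤ ℤ.+ - (+ y)                       ≡⟨ ℤ.+-identityˡ _ ⟩
    - (+ y)                              ∎

  imbalance-↑ʳ : ∀ q → imbalance A (x ↑ʳ q) ≡ + x
  imbalance-↑ʳ q = begin
    imbalance A (x ↑ʳ q)                 ≡⟨ imbalance-glue-↑ʳ {A = X} q ⟩
    ∑[ p < x ] 1ℤ ℤ.+ imbalance Y q      ≡⟨ cong₂ ℤ._+_ (∑-1 x) (regY q) ⟩
    + x ℤ.+ 0ℤ                           ≡⟨ ℤ.+-identityʳ _ ⟩
    + x                                  ∎

  imbalances : ImbalanceSetIs A (blockSet (x , y))
  imbalances z = realise , classify
    where
    realise : blockSet (x , y) z → ∃ λ v → imbalance A v ≡ z
    realise (inj₁ refl) = x ↑ʳ odd⇒Fin oy , imbalance-↑ʳ _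
    realise (inj₂ refl) = odd⇒Fin ox ↑ˡ y , imbalance-↑ˡ _
    classify : (∃ λ v → imbalance A v ≡ z) → blockSet (x , y) z
    classify (v , refl) with splitView x y v
    ... | left p  = inj₂ (imbalance-↑ˡ p)
    ... | right q = inj₁ (imbalance-↑ʳ q)

union : ∀ {a b S T} → Even a → Even b → TournamentWithImbalanceSet a S → TournamentWithImbalanceSet b T →
        TournamentWithImbalanceSet (a + b) (S ∪ T)
union {a} {b} {S} {T} ea eb (A , tA , setA) (B , tB , setB) = G , glue-isTournament tA tB , imbalances
  where
  G : Fin (a + b) → Fin (a + b) → Bool
  G = glue A B parityCross

  imbalances : ImbalanceSetIs G (S ∪ T)
  imbalances z = realise , classify
    where
    realise : (S ∪ T) z → ∃ λ v → imbalance G v ≡ z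
    realise (inj₁ sz) with proj₁ (setA z) sz
    ... | p , e = p ↑ˡ b , trans (imbalance-glue-parity-↑ˡ eb p) e
    realise (inj₂ tz) with proj₁ (setB z) tz
    ... | q , e = a ↑ʳ q , trans (imbalance-glue-parity-↑ʳ ea q) e
    classify : (∃ λ v → imbalance G v ≡ z) → (S ∪ T) z
    classify (v , e) with splitView a b v
    ... | left p  = inj₁ (proj₂ (setA z) (p , trans (sym (imbalance-glue-parity-↑ˡ eb p)) e))
    ... | right q = inj₂ (proj₂ (setB z) (q , trans (sym (imbalance-glue-parity-↑ʳ ea q)) e))

blocksSet : List (ℕ × ℕ) → ℤ → Set
blocksSet ps z = Any (λ xy → blockSet xy z) ps

blocksOrder : List (ℕ × ℕ) → ℕ
blocksOrder ps = sum (map (uncurry _+_) ps)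

blocks : ∀ ps → All (λ (x , y) → Odd x × Odd y) ps →
         Even (blocksOrder ps) × TournamentWithImbalanceSet (blocksOrder ps) (blocksSet ps)
blocks []             []                = zero , empty
  where
  empty : TournamentWithImbalanceSet 0 (blocksSet [])
  empty = (λ ()) , record { irrefl = λ () ; exactlyOne = λ () } , λ z → (λ ()) , λ { (() , _) }
blocks ((x , y) ∷ ps) ((ox , oy) ∷ ops) with blocks ps ops
... | eps , tps = even-+ exy eps , imbalanceSet-≐ (fromSum , toSum) (union exy eps (block ox oy) tps)
  where
  exy : Even (x + y)
  exy = odd+odd-even ox oy

blocksOrder-cartesianProduct : ∀ xs ys → blocksOrder (cartesianProduct xs ys) ≡ length xs * sum ys + length ys * sum xs
blocksOrder-cartesianProduct []       ys = sym (*-zeroʳ (length ys))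
blocksOrder-cartesianProduct (x ∷ xs) ys = begin
  sum (map (uncurry _+_) (map (x ,_) ys ++ cartesianProduct xs ys))
    ≡⟨ cong sum (map-++ (uncurry _+_) (map (x ,_) ys) _) ⟩
  sum (map (uncurry _+_) (map (x ,_) ys) ++ map (uncurry _+_) (cartesianProduct xs ys))
    ≡⟨ sum-++ (map (uncurry _+_) (map (x ,_) ys)) _ ⟩
  blocksOrder (map (x ,_) ys) + blocksOrder (cartesianProduct xs ys)
    ≡⟨ cong₂ _+_ (row ys) (blocksOrder-cartesianProduct xs ys) ⟩
  (length ys * x + sum ys) + (length xs * sum ys + length ys * sum xs)
    ≡⟨ rearrange (length ys) x (sum ys) (length xs) (sum xs) ⟩
  suc (length xs) * sum ys + length ys * (x + sum xs)
    ∎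
  where
  shuffle : ∀ x y m M → (x + y) + (m * x + M) ≡ suc m * x + (y + M)
  shuffle = solve-∀
  row : ∀ ys → blocksOrder (map (x ,_) ys) ≡ length ys * x + sum ys
  row []       = refl
  row (y ∷ ys) = trans (cong (_+_ (x + y)) (row ys)) (shuffle x y (length ys) (sum ys))
  rearrange : ∀ m x M l L → (m * x + M) + (l * M + m * L) ≡ suc l * M + m * (x + L)
  rearrange = solve-∀

blocksSet-cartesianProduct : ∀ x xs y ys →
  blocksSet (cartesianProduct (x ∷ xs) (y ∷ ys)) ≐ XunionY (x ∷ xs) (y ∷ ys)
blocksSet-cartesianProduct x xs y ys = toXunionY , fromXunionY
  where
  toXunionY : ∀ {z} → blocksSet (cartesianProduct (x ∷ xs) (y ∷ ys)) z → XunionY (x ∷ xs) (y ∷ ys) z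
  toXunionY b with find b
  ... | (x′ , _) , xy∈ , inj₁ z≡x′ = inj₁ (x′ , proj₁ (∈-cartesianProduct⁻ (x ∷ xs) (y ∷ ys) xy∈) , z≡x′)
  ... | (_ , y′) , xy∈ , inj₂ z≡y′ = inj₂ (y′ , proj₂ (∈-cartesianProduct⁻ (x ∷ xs) (y ∷ ys) xy∈) , z≡y′)
  fromXunionY : ∀ {z} → XunionY (x ∷ xs) (y ∷ ys) z → blocksSet (cartesianProduct (x ∷ xs) (y ∷ ys)) z
  fromXunionY (inj₁ (x′ , x′∈ , z≡x′)) = lose (∈-cartesianProduct⁺ x′∈ (here refl)) (inj₁ z≡x′)
  fromXunionY (inj₂ (y′ , y′∈ , z≡y′)) = lose (∈-cartesianProduct⁺ {xs = x ∷ xs} (here refl) y′∈) (inj₂ z≡y′)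

theorem2p3 : (xs ys : List ℕ) →
    length xs ≥ 1 → length ys ≥ 1 →
    StrictDec xs → StrictInc ys →
    All (λ x → 0 < x × Odd x) xs → All (λ y → 0 < y × Odd y) ys →
    Σ (Fin (length xs * sum ys + length ys * sum xs) → Fin (length xs * sum ys + length ys * sum xs) → Bool)
      (λ A → IsTournament (length xs * sum ys + length ys * sum xs) A × ImbalanceSetIs A (XunionY xs ys))
theorem2p3 []       _        ()
theorem2p3 (_ ∷ _)  []       _ ()
theorem2p3 (x ∷ xs) (y ∷ ys) _ _ _ _ xs-odd ys-odd =
  subst (λ n → TournamentWithImbalanceSet n (XunionY (x ∷ xs) (y ∷ ys)))
    (blocksOrder-cartesianProduct (x ∷ xs) (y ∷ ys))
    (imbalanceSet-≐ (blocksSet-cartesianProduct x xs y ys)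
      (proj₂ (blocks (cartesianProduct (x ∷ xs) (y ∷ ys)) (All.tabulate odd-pair))))
  where
  odd-pair : ∀ {xy} → xy ∈ cartesianProduct (x ∷ xs) (y ∷ ys) → Odd (proj₁ xy) × Odd (proj₂ xy)
  odd-pair xy∈ with ∈-cartesianProduct⁻ (x ∷ xs) (y ∷ ys) xy∈
  ... | x∈ , y∈ = proj₂ (All.lookup xs-odd x∈) , proj₂ (All.lookup ys-odd y∈)
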